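{- For GCWN networks $M,M',N$ and any label $\delta$ (either $p:\alpha$ or $\tau$): if $M\xrightarrow{\delta}M'$ and $M\equiv N$, then there exists $N'$ such that $N\xrightarrow{\delta}N'$ and $M'\equiv N'$.
   Context: GCWN. Graphs $G=(|G|,\frown_G)$: finite sets of locations with symmetric irreflexive edges; $G\oplus_DH$ for disjoint $G,H$, $D\subseteq|G|\times|H|$, has locations $|G|\cup|H|$ and the edges of $G$, $H$, $D$ (symmetrically). Processes (closed expressions evaluated by $\mathsf{eval}$, constants $A(\vec x)\stackrel{\rm def}{=}P$): $P::=\mathbf 0\mid c(x).P\mid\overline c(e).P\mid P+Q\mid\mathbf{if}\ b\ \mathbf{then}\ P\ \mathbf{else}\ Q\mid A(\vec v)$. Networks $M::=G\langle\Phi\rangle\mid M\backslash c\mid M\oplus_DN$ ($\Phi:|G|\to$ processes, $c$ bound in $M\backslash c$); for $M=G\langle\Phi\rangle\backslash I$, $N=H\langle\Psi\rangle\backslash J$ (disjoint, $I\cap J=\emptyset$), $M\oplus_DN=(G\oplus_DH)\langle\Phi'\rangle\backslash(I\cup J)$; $|M|=|G|$, $M(p)=\Phi(p)$, $M[p\mapsto Q]$ replaces the process at $p$. Networks are data-closed. Structural congruence $\equiv$: smallest congruence with $P+\mathbf 0\equiv P$, $P+Q\equiv Q+P$, $P+(Q+R)\equiv(P+Q)+R$, conditionals $\equiv$ the branch selected by $\mathsf{eval}(b)$, $A(\vec v)\equiv P\{\vec v/\vec x\}$ if $A(\vec x)\stackrel{\rm def}{=}P$, $\alpha$-conversion, $M\backslash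 c\backslash d\equiv M\backslash d\backslash c$, $M\oplus_DN\equiv N\oplus_DM$, $(M\oplus_DN)\backslash c\equiv M\oplus_D(N\backslash c)$ if $c,\overline c$ not in $M$, $G\langle\Phi\rangle\equiv G\langle\Psi\rangle$ if pointwise $\equiv$. Labelled transitions (actions $\alpha::=cv\mid\overline cv$, labels $\delta::=p:\alpha\mid\tau$): $\overline c(e).P\xrightarrow{\overline cv}P$ ($\mathsf{eval}(e)=v$), $c(x).P\xrightarrow{cv}P\{v/x\}$, sums choose a summand, conditionals act as the selected branch, $A(\vec v)$ as $P\{\vec v/\vec x\}$; $M(p)\xrightarrow{\alpha}P'$ gives $M\xrightarrow{p:\alpha}M[p\mapsto P']$; $M\xrightarrow{p:\overline cv}M'$, $N\xrightarrow{q:cv}N'$, $(p,q)\in D$ give $M\oplus_DN\xrightarrow{p:\overline cv}M'\oplus_DN'$ and $N\oplus_DM\xrightarrow{p:\overline cv}N'\oplus_DM'$; $M\xrightarrow{p:\overline cv}M'$ gives $M\backslash c\xrightarrow{\tau}M'\backslash c$; $M\xrightarrow{\delta}M'$ ($c,\overline c$ not in $\delta$) gives $M\backslash c\xrightarrow{\delta}M'\backslash c$; $M\xrightarrow{\delta}M'$ gives $M\oplus_DN\xrightarrow{\delta}M'\oplus_DN$ and $N\oplus_DM\xrightarrow{\delta}N\oplus_DM'$. -}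

module Defs where

open import Data.Nat using (ℕ; zero; suc; _≟_; _≡ᵇ_; _≤ᵇ_) renaming (_+_ to _+ℕ_)
open import Data.Bool using (Bool; true; false; not; _∧_; if_then_else_)
open import Data.Fin using (Fin; zero; suc)
open import Data.List using (List; []; _∷_; map)
open import Data.List.Membership.Propositional using (_∈_)
open import Data.List.Relation.Unary.Unique.Propositional using (Unique)
open import Data.Maybe using (Maybe; just; nothing; _>>=_)
open import Data.Product using (Σ; _×_; _,_; proj₁; proj₂)
open import Data.Sum using (_⊎_)
open import Data.Unit using (⊤)
open import Relation.Binary.PropositionalEquality using (_≡_; _≢_)
open import Relation.Nullary using (¬_; yes; no)

Val : Set
Val = ℕ

Chan : Set
Chan = ℕ

Loc : Set
Loc = ℕ

ConstName : Set
ConstName = ℕ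

-- Data expressions, scoped by the number n of free (de Bruijn) variables.
-- eval is only defined (just) on closed expressions.

data Exp (n : ℕ) : Set where
  var  : Fin n → Exp n
  lit  : Val → Exp n
  plus : Exp n → Exp n → Exp n

data BExp (n : ℕ) : Set where
  tt ff  : BExp n
  eq leq : Exp n → Exp n → BExp n
  neg    : BExp n → BExp n
  conj   : BExp n → BExp n → BExp n

eval : ∀ {n} → Exp n → Maybe Val
eval (var _)    = nothing
eval (lit v)    = just v
eval (plus a b) = eval a >>= λ x → eval b >>= λ y → just (x +ℕ y)

evalB : ∀ {n} → BExp n → Maybe Bool
evalB tt         = just true
evalB ff         = just false
evalB (eq a b)   = eval a >>= λ x → eval b >>= λ y → just (x ≡ᵇ y)
evalB (leq a b)  = eval a >>= λ x → eval b >>= λ y → just (x ≤ᵇ y)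
evalB (neg b)    = evalB b >>= λ x → just (not x)
evalB (conj a b) = evalB a >>= λ x → evalB b >>= λ y → just (x ∧ y)

evalAll : ∀ {n} → List (Exp n) → Maybe (List Val)
evalAll []       = just []
evalAll (e ∷ es) = eval e >>= λ v → evalAll es >>= λ vs → just (v ∷ vs)

-- Processes P ::= 0 | c(x).P | c̄(e).P | P + Q | if b then P else Q | A(e⃗)
-- (variables are de Bruijn indices; c(x).P binds index 0 in P)

infixl 5 _⊞_

data Proc (n : ℕ) : Set where
  𝟎    : Proc n
  inp  : Chan → Proc (suc n) → Proc n
  out  : Chan → Exp n → Proc n → Proc n
  _⊞_  : Proc n → Proc n → Proc n
  ifte : BExp n → Proc n → Proc n → Proc n
  call : ConstName → List (Exp n) → Proc n

Sub : ℕ → ℕ → Set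
Sub n m = Fin n → Exp m

renE : ∀ {n m} → (Fin n → Fin m) → Exp n → Exp m
renE ρ (var i)    = var (ρ i)
renE ρ (lit v)    = lit v
renE ρ (plus a b) = plus (renE ρ a) (renE ρ b)

subE : ∀ {n m} → Sub n m → Exp n → Exp m
subE σ (var i)    = σ i
subE σ (lit v)    = lit v
subE σ (plus a b) = plus (subE σ a) (subE σ b)

subB : ∀ {n m} → Sub n m → BExp n → BExp m
subB σ tt         = tt
subB σ ff         = ff
subB σ (eq a b)   = eq (subE σ a) (subE σ b)
subB σ (leq a b)  = leq (subE σ a) (subE σ b)
subB σ (neg b)    = neg (subB σ b)
subB σ (conj a b) = conj (subB σ a) (subB σ b)

liftS : ∀ {n m} → Sub n m → Sub (suc n) (suc m)
liftS σ zero    = var zero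
liftS σ (suc i) = renE suc (σ i)

subP : ∀ {n m} → Sub n m → Proc n → Proc m
subP σ 𝟎            = 𝟎
subP σ (inp c P)    = inp c (subP (liftS σ) P)
subP σ (out c e P)  = out c (subE σ e) (subP σ P)
subP σ (P ⊞ Q)      = subP σ P ⊞ subP σ Q
subP σ (ifte b P Q) = ifte (subB σ b) (subP σ P) (subP σ Q)
subP σ (call A es)  = call A (map (subE σ) es)

_[_]₀ : Proc 1 → Val → Proc 0
P [ v ]₀ = subP (λ { zero → lit v }) P

weaken : ∀ {n} → Proc 0 → Proc n
weaken = subP (λ ())

-- Process constants: an environment of definitions A(x₁..xₙ) ≝ P,
-- with P : Proc n.

Env : Set
Env = ConstName → Σ ℕ Proc

toArgs : (n : ℕ) → List Val → Maybe (Sub n 0)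
toArgs zero    []       = just (λ ())
toArgs zero    (_ ∷ _)  = nothing
toArgs (suc n) []       = nothing
toArgs (suc n) (v ∷ vs) = toArgs n vs >>= λ σ → just (λ { zero → lit v ; (suc i) → σ i })

-- P{v⃗/x⃗} (nothing on arity mismatch)
instantiate : Σ ℕ Proc → List Val → Maybe (Proc 0)
instantiate (n , P) vs = toArgs n vs >>= λ σ → just (subP σ P)

infix 4 _⊢_≈ₚ_

data _⊢_≈ₚ_ (Δ : Env) : ∀ {n} → Proc n → Proc n → Set where
  ≈-refl  : ∀ {n} {P : Proc n} → Δ ⊢ P ≈ₚ P
  ≈-sym   : ∀ {n} {P Q : Proc n} → Δ ⊢ P ≈ₚ Q → Δ ⊢ Q ≈ₚ P
  ≈-trans : ∀ {n} {P Q R : Proc n} → Δ ⊢ P ≈ₚ Q → Δ ⊢ Q ≈ₚ R → Δ ⊢ P ≈ₚ R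
  inp-cong : ∀ {n c} {P Q : Proc (suc n)} → Δ ⊢ P ≈ₚ Q → Δ ⊢ inp c P ≈ₚ inp c Q
  out-cong : ∀ {n c e} {P Q : Proc n} → Δ ⊢ P ≈ₚ Q → Δ ⊢ out c e P ≈ₚ out c e Q
  sum-cong : ∀ {n} {P P' Q Q' : Proc n} → Δ ⊢ P ≈ₚ P' → Δ ⊢ Q ≈ₚ Q' → Δ ⊢ P ⊞ Q ≈ₚ P' ⊞ Q'
  if-cong  : ∀ {n b} {P P' Q Q' : Proc n} → Δ ⊢ P ≈ₚ P' → Δ ⊢ Q ≈ₚ Q' →
             Δ ⊢ ifte b P Q ≈ₚ ifte b P' Q'
  sum-unit  : ∀ {n} {P : Proc n} → Δ ⊢ P ⊞ 𝟎 ≈ₚ P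
  sum-comm  : ∀ {n} {P Q : Proc n} → Δ ⊢ P ⊞ Q ≈ₚ Q ⊞ P
  sum-assoc : ∀ {n} {P Q R : Proc n} → Δ ⊢ P ⊞ (Q ⊞ R) ≈ₚ (P ⊞ Q) ⊞ R
  if-true  : ∀ {n b} {P Q : Proc n} → evalB b ≡ just true  → Δ ⊢ ifte b P Q ≈ₚ P
  if-false : ∀ {n b} {P Q : Proc n} → evalB b ≡ just false → Δ ⊢ ifte b P Q ≈ₚ Q
  unfold   : ∀ {n A vs R} {es : List (Exp n)} → evalAll es ≡ just vs →
             instantiate (Δ A) vs ≡ just R → Δ ⊢ call A es ≈ₚ weaken R

data Act : Set where
  recv : Chan → Val → Act
  send : Chan → Val → Act

chanOf : Act → Chan
chanOf (recv c _) = c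
chanOf (send c _) = c

infix 6 _∶_

data Label : Set where
  _∶_ : Loc → Act → Label
  τ   : Label

NotOn : Chan → Label → Set
NotOn c (p ∶ α) = chanOf α ≢ c
NotOn c τ       = ⊤

infix 4 _⊢_—[_]→ₚ_

data _⊢_—[_]→ₚ_ (Δ : Env) : Proc 0 → Act → Proc 0 → Set where
  out-tr : ∀ {c e v P} → eval e ≡ just v → Δ ⊢ out c e P —[ send c v ]→ₚ P
  inp-tr : ∀ {c v P} → Δ ⊢ inp c P —[ recv c v ]→ₚ (P [ v ]₀)
  sumL   : ∀ {P Q α P'} → Δ ⊢ P —[ α ]→ₚ P' → Δ ⊢ P ⊞ Q —[ α ]→ₚ P'
  sumR   : ∀ {P Q α Q'} → Δ ⊢ Q —[ α ]→ₚ Q' → Δ ⊢ P ⊞ Q —[ α ]→ₚ Q'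
  ifT    : ∀ {b P Q α P'} → evalB b ≡ just true → Δ ⊢ P —[ α ]→ₚ P' →
           Δ ⊢ ifte b P Q —[ α ]→ₚ P'
  ifF    : ∀ {b P Q α Q'} → evalB b ≡ just false → Δ ⊢ Q —[ α ]→ₚ Q' →
           Δ ⊢ ifte b P Q —[ α ]→ₚ Q'
  call-tr : ∀ {A es vs R α R'} → evalAll es ≡ just vs → instantiate (Δ A) vs ≡ just R →
            Δ ⊢ R —[ α ]→ₚ R' → Δ ⊢ call A es —[ α ]→ₚ R'

record Graph : Set where
  field
    locs         : List Loc
    locs-unique  : Unique locs
    edges        : List (Loc × Loc)
    edges-sym    : ∀ {p q} → (p , q) ∈ edges → (q , p) ∈ edges
    edges-irrefl : ∀ {p} → ¬ ((p , p) ∈ edges)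
    edges-in     : ∀ {p q} → (p , q) ∈ edges → (p ∈ locs) × (q ∈ locs)

open Graph public

infixl 7 _∖_
infixl 6 _⊕[_]_

data Net : Set where
  _⟨_⟩  : Graph → (Loc → Proc 0) → Net
  _∖_   : Net → Chan → Net
  _⊕[_]_ : Net → List (Loc × Loc) → Net → Net

_[_↦_] : (Loc → Proc 0) → Loc → Proc 0 → (Loc → Proc 0)
(Φ [ p ↦ Q ]) q with p ≟ q
... | yes _ = Q
... | no  _ = Φ q

data OccP (Δ : Env) (c : Chan) : ∀ {n} → Proc n → Set where
  inp-here  : ∀ {n} {P : Proc (suc n)} → OccP Δ c (inp c P)
  inp-there : ∀ {n d} {P : Proc (suc n)} → OccP Δ c P → OccP Δ c (inp d P)
  out-here  : ∀ {n e} {P : Proc n} → OccP Δ c (out c e P)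
  out-there : ∀ {n d e} {P : Proc n} → OccP Δ c P → OccP Δ c (out d e P)
  sumL      : ∀ {n} {P Q : Proc n} → OccP Δ c P → OccP Δ c (P ⊞ Q)
  sumR      : ∀ {n} {P Q : Proc n} → OccP Δ c Q → OccP Δ c (P ⊞ Q)
  ifL       : ∀ {n b} {P Q : Proc n} → OccP Δ c P → OccP Δ c (ifte b P Q)
  ifR       : ∀ {n b} {P Q : Proc n} → OccP Δ c Q → OccP Δ c (ifte b P Q)
  call-body : ∀ {n A} {es : List (Exp n)} → OccP Δ c (proj₂ (Δ A)) → OccP Δ c (call A es)

OccFree : Env → Chan → Net → Set
OccFree Δ c (G ⟨ Φ ⟩)     = Σ Loc λ p → (p ∈ locs G) × OccP Δ c (Φ p)
OccFree Δ c (M ∖ d)       = (c ≢ d) × OccFree Δ c M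
OccFree Δ c (M ⊕[ D ] N)  = OccFree Δ c M ⊎ OccFree Δ c N

OccAll : Env → Chan → Net → Set
OccAll Δ c (G ⟨ Φ ⟩)     = Σ Loc λ p → (p ∈ locs G) × OccP Δ c (Φ p)
OccAll Δ c (M ∖ d)       = (c ≡ d) ⊎ OccAll Δ c M
OccAll Δ c (M ⊕[ D ] N)  = OccAll Δ c M ⊎ OccAll Δ c N

-- renaming of free channel c into d (syntactic; does not enter constant bodies)
renCh : Chan → Chan → Chan → Chan
renCh c d x with x ≟ c
... | yes _ = d
... | no  _ = x

renP : ∀ {n} → Chan → Chan → Proc n → Proc n
renP c d 𝟎            = 𝟎
renP c d (inp x P)    = inp (renCh c d x) (renP c d P)
renP c d (out x e P)  = out (renCh c d x) e (renP c d P)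
renP c d (P ⊞ Q)      = renP c d P ⊞ renP c d Q
renP c d (ifte b P Q) = ifte b (renP c d P) (renP c d Q)
renP c d (call A es)  = call A es

renN : Chan → Chan → Net → Net
renN c d (G ⟨ Φ ⟩) = G ⟨ (λ p → renP c d (Φ p)) ⟩
renN c d (M ∖ e) with e ≟ c
... | yes _ = M ∖ e
... | no  _ = renN c d M ∖ e
renN c d (M ⊕[ D ] N) = renN c d M ⊕[ D ] renN c d N

infix 4 _⊢_≅_

data _⊢_≅_ (Δ : Env) : Net → Net → Set where
  ≅-refl  : ∀ {M} → Δ ⊢ M ≅ M
  ≅-sym   : ∀ {M N} → Δ ⊢ M ≅ N → Δ ⊢ N ≅ M
  ≅-trans : ∀ {M N K} → Δ ⊢ M ≅ N → Δ ⊢ N ≅ K → Δ ⊢ M ≅ K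
  res-cong : ∀ {M N c} → Δ ⊢ M ≅ N → Δ ⊢ M ∖ c ≅ N ∖ c
  par-cong : ∀ {M M' N N' D} → Δ ⊢ M ≅ M' → Δ ⊢ N ≅ N' → Δ ⊢ M ⊕[ D ] N ≅ M' ⊕[ D ] N'
  loc-cong : ∀ {G Φ Ψ} → (∀ p → p ∈ locs G → Δ ⊢ Φ p ≈ₚ Ψ p) → Δ ⊢ G ⟨ Φ ⟩ ≅ G ⟨ Ψ ⟩
  res-swap : ∀ {M c d} → Δ ⊢ M ∖ c ∖ d ≅ M ∖ d ∖ c
  par-comm : ∀ {M N D} → Δ ⊢ M ⊕[ D ] N ≅ N ⊕[ D ] M
  scope    : ∀ {M N D c} → ¬ OccFree Δ c M → Δ ⊢ (M ⊕[ D ] N) ∖ c ≅ M ⊕[ D ] (N ∖ c)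
  alpha    : ∀ {M c d} → ¬ OccAll Δ d M → ¬ OccFree Δ c (renN c d M) →
             Δ ⊢ M ∖ c ≅ renN c d M ∖ d

infix 4 _⊢_—[_]→_

data _⊢_—[_]→_ (Δ : Env) : Net → Label → Net → Set where
  loc-tr : ∀ {G Φ p α P'} → p ∈ locs G → Δ ⊢ Φ p —[ α ]→ₚ P' →
           Δ ⊢ G ⟨ Φ ⟩ —[ p ∶ α ]→ G ⟨ Φ [ p ↦ P' ] ⟩
  syncL  : ∀ {M M' N N' D p q c v} → Δ ⊢ M —[ p ∶ send c v ]→ M' →
           Δ ⊢ N —[ q ∶ recv c v ]→ N' → (p , q) ∈ D →
           Δ ⊢ M ⊕[ D ] N —[ p ∶ send c v ]→ M' ⊕[ D ] N'
  syncR  : ∀ {M M' N N' D p q c v} → Δ ⊢ M —[ p ∶ send c v ]→ M' →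
           Δ ⊢ N —[ q ∶ recv c v ]→ N' → (p , q) ∈ D →
           Δ ⊢ N ⊕[ D ] M —[ p ∶ send c v ]→ N' ⊕[ D ] M'
  hide   : ∀ {M M' p c v} → Δ ⊢ M —[ p ∶ send c v ]→ M' → Δ ⊢ M ∖ c —[ τ ]→ M' ∖ c
  pass   : ∀ {M M' δ c} → NotOn c δ → Δ ⊢ M —[ δ ]→ M' → Δ ⊢ M ∖ c —[ δ ]→ M' ∖ c
  parL   : ∀ {M M' N D δ} → Δ ⊢ M —[ δ ]→ M' → Δ ⊢ M ⊕[ D ] N —[ δ ]→ M' ⊕[ D ] N
  parR   : ∀ {M M' N D δ} → Δ ⊢ M —[ δ ]→ M' → Δ ⊢ N ⊕[ D ] M —[ δ ]→ N ⊕[ D ] M'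

-- Since ≅ is closed under symmetry, one proves
-- by simultaneous induction on M ≅ N that N simulates M and M simulates N up to ≅: reflexivity
-- and transitivity are closure properties of simulations, the congruence rules lift simulations
-- through restriction, composition and the process map, and each axiom is checked directly.
-- At a location this is the same statement for ≈ₚ on processes, where input prefixes need ≈ₚ
-- to be stable under substitution. Scope extrusion uses that a network only acts on channels
-- free in it; α-conversion uses that renaming c to a fresh d transports the transitions of M
-- to those of M{d/c} and back, relabelled accordingly.

module Submission where

open import Defs
open import Data.Empty using (⊥-elim)
open import Data.Fin using (zero; suc)
open import Data.List using (List; []; _∷_; map)
open import Data.List.Membership.Propositional using (_∈_)
open import Data.List.Properties using (map-cong; map-∘; map-id)
open import Data.Maybe using (Maybe; just; nothing; _>>=_)
open import Data.Maybe.Properties using (just-injective)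
open import Data.Nat using (ℕ; suc; _≟_)
open import Data.Product using (Σ; _×_; _,_; proj₁; proj₂; map₁; map₂)
open import Data.Sum using (_⊎_; inj₁; inj₂) renaming (map to ⊎-map; map₂ to ⊎-map₂)
open import Data.Unit using (tt)
open import Function using (_∘_)
open import Relation.Binary using (Reflexive; Transitive)
open import Relation.Binary.PropositionalEquality
  using (_≡_; _≢_; refl; sym; trans; cong; cong₂; subst; subst₂; ≢-sym)
open import Relation.Nullary using (¬_; yes; no)

-- Evaluation and substitution

infix 4 _⊑_

_⊑_ : {A : Set} → Maybe A → Maybe A → Set
m ⊑ m' = ∀ {x} → m ≡ just x → m' ≡ just x

⊑-refl : {A : Set} {m : Maybe A} → m ⊑ m
⊑-refl h = h

>>=-mono-⊑ : {A B : Set} {m m' : Maybe A} {f g : A → Maybe B} →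
             m ⊑ m' → (∀ x → f x ⊑ g x) → (m >>= f) ⊑ (m' >>= g)
>>=-mono-⊑ {m = just x} m⊑m' f⊑g h rewrite m⊑m' refl = f⊑g x h
>>=-mono-⊑ {m = nothing} _ _ ()

eval-subE : ∀ {n m} (σ : Sub n m) (e : Exp n) → eval e ⊑ eval (subE σ e)
eval-subE σ (var i) ()
eval-subE σ (lit v) = ⊑-refl
eval-subE σ (plus a b) =
  >>=-mono-⊑ (eval-subE σ a) λ _ → >>=-mono-⊑ (eval-subE σ b) λ _ → ⊑-refl

evalB-subB : ∀ {n m} (σ : Sub n m) (b : BExp n) → evalB b ⊑ evalB (subB σ b)
evalB-subB σ tt = ⊑-refl
evalB-subB σ ff = ⊑-refl
evalB-subB σ (eq a b) =
  >>=-mono-⊑ (eval-subE σ a) λ _ → >>=-mono-⊑ (eval-subE σ b) λ _ → ⊑-refl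
evalB-subB σ (leq a b) =
  >>=-mono-⊑ (eval-subE σ a) λ _ → >>=-mono-⊑ (eval-subE σ b) λ _ → ⊑-refl
evalB-subB σ (neg b) = >>=-mono-⊑ (evalB-subB σ b) λ _ → ⊑-refl
evalB-subB σ (conj a b) =
  >>=-mono-⊑ (evalB-subB σ a) λ _ → >>=-mono-⊑ (evalB-subB σ b) λ _ → ⊑-refl

evalAll-subE : ∀ {n m} (σ : Sub n m) (es : List (Exp n)) →
               evalAll es ⊑ evalAll (map (subE σ) es)
evalAll-subE σ [] = ⊑-refl
evalAll-subE σ (e ∷ es) =
  >>=-mono-⊑ (eval-subE σ e) λ _ → >>=-mono-⊑ (evalAll-subE σ es) λ _ → ⊑-refl

subE-liftS-renE : ∀ {n m} (σ : Sub n m) (e : Exp n) →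
                  subE (liftS σ) (renE suc e) ≡ renE suc (subE σ e)
subE-liftS-renE σ (var i)    = refl
subE-liftS-renE σ (lit v)    = refl
subE-liftS-renE σ (plus a b) = cong₂ plus (subE-liftS-renE σ a) (subE-liftS-renE σ b)

module _ {n m k : ℕ} (σ : Sub m k) (ρ : Sub n m) (σρ : Sub n k)
         (fuse : ∀ i → subE σ (ρ i) ≡ σρ i) where

  subE-fuse : ∀ e → subE σ (subE ρ e) ≡ subE σρ e
  subE-fuse (var i)    = fuse i
  subE-fuse (lit v)    = refl
  subE-fuse (plus a b) = cong₂ plus (subE-fuse a) (subE-fuse b)

  subB-fuse : ∀ b → subB σ (subB ρ b) ≡ subB σρ b
  subB-fuse tt         = refl
  subB-fuse ff         = refl
  subB-fuse (eq a b)   = cong₂ eq (subE-fuse a) (subE-fuse b)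
  subB-fuse (leq a b)  = cong₂ leq (subE-fuse a) (subE-fuse b)
  subB-fuse (neg b)    = cong neg (subB-fuse b)
  subB-fuse (conj a b) = cong₂ conj (subB-fuse a) (subB-fuse b)

  liftS-fuse : ∀ i → subE (liftS σ) (liftS ρ i) ≡ liftS σρ i
  liftS-fuse zero    = refl
  liftS-fuse (suc i) = trans (subE-liftS-renE σ (ρ i)) (cong (renE suc) (fuse i))

subP-fuse : ∀ {n m k} (σ : Sub m k) (ρ : Sub n m) (σρ : Sub n k) →
            (∀ i → subE σ (ρ i) ≡ σρ i) → ∀ P → subP σ (subP ρ P) ≡ subP σρ P
subP-fuse σ ρ σρ fuse 𝟎 = refl
subP-fuse σ ρ σρ fuse (inp c P) =
  cong (inp c) (subP-fuse (liftS σ) (liftS ρ) (liftS σρ) (liftS-fuse σ ρ σρ fuse) P)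
subP-fuse σ ρ σρ fuse (out c e P) =
  cong₂ (out c) (subE-fuse σ ρ σρ fuse e) (subP-fuse σ ρ σρ fuse P)
subP-fuse σ ρ σρ fuse (P ⊞ Q) = cong₂ _⊞_ (subP-fuse σ ρ σρ fuse P) (subP-fuse σ ρ σρ fuse Q)
subP-fuse σ ρ σρ fuse (ifte b P Q)
  rewrite subB-fuse σ ρ σρ fuse b | subP-fuse σ ρ σρ fuse P | subP-fuse σ ρ σρ fuse Q = refl
subP-fuse σ ρ σρ fuse (call A es) =
  cong (call A) (trans (sym (map-∘ es)) (map-cong (subE-fuse σ ρ σρ fuse) es))

module _ {n : ℕ} (σ : Sub n n) (σ≗var : ∀ i → σ i ≡ var i) where

  subE-id : ∀ e → subE σ e ≡ e
  subE-id (var i)    = σ≗var i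
  subE-id (lit v)    = refl
  subE-id (plus a b) = cong₂ plus (subE-id a) (subE-id b)

  subB-id : ∀ b → subB σ b ≡ b
  subB-id tt         = refl
  subB-id ff         = refl
  subB-id (eq a b)   = cong₂ eq (subE-id a) (subE-id b)
  subB-id (leq a b)  = cong₂ leq (subE-id a) (subE-id b)
  subB-id (neg b)    = cong neg (subB-id b)
  subB-id (conj a b) = cong₂ conj (subB-id a) (subB-id b)

  liftS-id : ∀ i → liftS σ i ≡ var i
  liftS-id zero    = refl
  liftS-id (suc i) = cong (renE suc) (σ≗var i)

subP-id : ∀ {n} (σ : Sub n n) → (∀ i → σ i ≡ var i) → ∀ P → subP σ P ≡ P
subP-id σ σ≗var 𝟎            = refl
subP-id σ σ≗var (inp c P)    = cong (inp c) (subP-id (liftS σ) (liftS-id σ σ≗var) P)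
subP-id σ σ≗var (out c e P)  = cong₂ (out c) (subE-id σ σ≗var e) (subP-id σ σ≗var P)
subP-id σ σ≗var (P ⊞ Q)      = cong₂ _⊞_ (subP-id σ σ≗var P) (subP-id σ σ≗var Q)
subP-id σ σ≗var (ifte b P Q)
  rewrite subB-id σ σ≗var b | subP-id σ σ≗var P | subP-id σ σ≗var Q = refl
subP-id σ σ≗var (call A es)  =
  cong (call A) (trans (map-cong (subE-id σ σ≗var) es) (map-id es))

subP-weaken : ∀ {m k} (σ : Sub m k) (R : Proc 0) → subP σ (weaken {m} R) ≡ weaken R
subP-weaken σ = subP-fuse σ _ _ λ ()

weaken-closed : (R : Proc 0) → weaken R ≡ R
weaken-closed = subP-id _ λ ()

-- Structural congruence of processes is a bisimulation

module Simulation {S L : Set} (Step : S → L → S → Set) (_∼_ : S → S → Set) where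

  Sim : S → S → Set
  Sim P Q = ∀ {l P'} → Step P l P' → Σ S λ Q' → Step Q l Q' × P' ∼ Q'

  sim-refl : Reflexive _∼_ → ∀ {P} → Sim P P
  sim-refl ∼-refl t = _ , t , ∼-refl

  sim-trans : Transitive _∼_ → ∀ {P Q R} → Sim P Q → Sim Q R → Sim P R
  sim-trans ∼-trans P≲Q Q≲R t with P≲Q t
  ... | Q' , t′ , P'∼Q' = map₂ (map₂ (∼-trans P'∼Q')) (Q≲R t′)

ProcSim : Env → Proc 0 → Proc 0 → Set
ProcSim Δ = Simulation.Sim (Δ ⊢_—[_]→ₚ_) (Δ ⊢_≈ₚ_)

NetSim : Env → Net → Net → Set
NetSim Δ = Simulation.Sim (Δ ⊢_—[_]→_) (Δ ⊢_≅_)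

module _ {Δ : Env} where

  ≈ₚ-subP : ∀ {n m} (σ : Sub n m) {P Q : Proc n} → Δ ⊢ P ≈ₚ Q → Δ ⊢ subP σ P ≈ₚ subP σ Q
  ≈ₚ-subP σ ≈-refl            = ≈-refl
  ≈ₚ-subP σ (≈-sym P≈Q)       = ≈-sym (≈ₚ-subP σ P≈Q)
  ≈ₚ-subP σ (≈-trans P≈Q Q≈R) = ≈-trans (≈ₚ-subP σ P≈Q) (≈ₚ-subP σ Q≈R)
  ≈ₚ-subP σ (inp-cong P≈Q)    = inp-cong (≈ₚ-subP (liftS σ) P≈Q)
  ≈ₚ-subP σ (out-cong P≈Q)    = out-cong (≈ₚ-subP σ P≈Q)
  ≈ₚ-subP σ (sum-cong P≈Q R≈S) = sum-cong (≈ₚ-subP σ P≈Q) (≈ₚ-subP σ R≈S)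
  ≈ₚ-subP σ (if-cong P≈Q R≈S)  = if-cong (≈ₚ-subP σ P≈Q) (≈ₚ-subP σ R≈S)
  ≈ₚ-subP σ sum-unit          = sum-unit
  ≈ₚ-subP σ sum-comm          = sum-comm
  ≈ₚ-subP σ sum-assoc         = sum-assoc
  ≈ₚ-subP σ (if-true {b = b} b⇓)  = if-true (evalB-subB σ b b⇓)
  ≈ₚ-subP σ (if-false {b = b} b⇓) = if-false (evalB-subB σ b b⇓)
  ≈ₚ-subP σ (unfold {A = A} {R = R} {es = es} es⇓ inst) =
    subst (Δ ⊢ call A (map (subE σ) es) ≈ₚ_) (sym (subP-weaken σ R))
          (unfold (evalAll-subE σ es es⇓) inst)

  open Simulation (Δ ⊢_—[_]→ₚ_) (Δ ⊢_≈ₚ_) using (sim-refl; sim-trans)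

  ≈ₚ-sim  : {P Q : Proc 0} → Δ ⊢ P ≈ₚ Q → ProcSim Δ P Q
  ≈ₚ-sim⁻ : {P Q : Proc 0} → Δ ⊢ P ≈ₚ Q → ProcSim Δ Q P

  ≈ₚ-sim ≈-refl                = sim-refl ≈-refl
  ≈ₚ-sim (≈-sym Q≈P)           = ≈ₚ-sim⁻ Q≈P
  ≈ₚ-sim (≈-trans P≈Q Q≈R)     = sim-trans ≈-trans (≈ₚ-sim P≈Q) (≈ₚ-sim Q≈R)
  ≈ₚ-sim (inp-cong P≈Q) inp-tr = _ , inp-tr , ≈ₚ-subP _ P≈Q
  ≈ₚ-sim (out-cong P≈Q) (out-tr e⇓) = _ , out-tr e⇓ , P≈Q
  ≈ₚ-sim (sum-cong P≈Q _) (sumL t) = map₂ (map₁ sumL) (≈ₚ-sim P≈Q t)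
  ≈ₚ-sim (sum-cong _ R≈S) (sumR t) = map₂ (map₁ sumR) (≈ₚ-sim R≈S t)
  ≈ₚ-sim (if-cong P≈Q _) (ifT b⇓ t) = map₂ (map₁ (ifT b⇓)) (≈ₚ-sim P≈Q t)
  ≈ₚ-sim (if-cong _ R≈S) (ifF b⇓ t) = map₂ (map₁ (ifF b⇓)) (≈ₚ-sim R≈S t)
  ≈ₚ-sim sum-unit (sumL t)          = _ , t , ≈-refl
  ≈ₚ-sim sum-comm (sumL t)          = _ , sumR t , ≈-refl
  ≈ₚ-sim sum-comm (sumR t)          = _ , sumL t , ≈-refl
  ≈ₚ-sim sum-assoc (sumL t)         = _ , sumL (sumL t) , ≈-refl
  ≈ₚ-sim sum-assoc (sumR (sumL t))  = _ , sumL (sumR t) , ≈-refl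
  ≈ₚ-sim sum-assoc (sumR (sumR t))  = _ , sumR t , ≈-refl
  ≈ₚ-sim (if-true _) (ifT _ t)      = _ , t , ≈-refl
  ≈ₚ-sim (if-true b⇓) (ifF b⇓′ _) with () ← trans (sym b⇓) b⇓′
  ≈ₚ-sim (if-false b⇓) (ifT b⇓′ _) with () ← trans (sym b⇓) b⇓′
  ≈ₚ-sim (if-false _) (ifF _ t)     = _ , t , ≈-refl
  ≈ₚ-sim (unfold {R = R} es⇓ inst) (call-tr es⇓′ inst′ t)
    with refl ← just-injective (trans (sym es⇓) es⇓′)
    with refl ← just-injective (trans (sym inst) inst′)
    = _ , subst (Δ ⊢_—[ _ ]→ₚ _) (sym (weaken-closed R)) t , ≈-refl

  ≈ₚ-sim⁻ ≈-refl                = sim-refl ≈-refl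
  ≈ₚ-sim⁻ (≈-sym Q≈P)           = ≈ₚ-sim Q≈P
  ≈ₚ-sim⁻ (≈-trans P≈Q Q≈R)     = sim-trans ≈-trans (≈ₚ-sim⁻ Q≈R) (≈ₚ-sim⁻ P≈Q)
  ≈ₚ-sim⁻ (inp-cong P≈Q) inp-tr = _ , inp-tr , ≈-sym (≈ₚ-subP _ P≈Q)
  ≈ₚ-sim⁻ (out-cong P≈Q) (out-tr e⇓) = _ , out-tr e⇓ , ≈-sym P≈Q
  ≈ₚ-sim⁻ (sum-cong P≈Q _) (sumL t) = map₂ (map₁ sumL) (≈ₚ-sim⁻ P≈Q t)
  ≈ₚ-sim⁻ (sum-cong _ R≈S) (sumR t) = map₂ (map₁ sumR) (≈ₚ-sim⁻ R≈S t)
  ≈ₚ-sim⁻ (if-cong P≈Q _) (ifT b⇓ t) = map₂ (map₁ (ifT b⇓)) (≈ₚ-sim⁻ P≈Q t)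
  ≈ₚ-sim⁻ (if-cong _ R≈S) (ifF b⇓ t) = map₂ (map₁ (ifF b⇓)) (≈ₚ-sim⁻ R≈S t)
  ≈ₚ-sim⁻ sum-unit t                = _ , sumL t , ≈-refl
  ≈ₚ-sim⁻ sum-comm (sumL t)         = _ , sumR t , ≈-refl
  ≈ₚ-sim⁻ sum-comm (sumR t)         = _ , sumL t , ≈-refl
  ≈ₚ-sim⁻ sum-assoc (sumL (sumL t)) = _ , sumL t , ≈-refl
  ≈ₚ-sim⁻ sum-assoc (sumL (sumR t)) = _ , sumR (sumL t) , ≈-refl
  ≈ₚ-sim⁻ sum-assoc (sumR t)        = _ , sumR (sumR t) , ≈-refl
  ≈ₚ-sim⁻ (if-true b⇓) t            = _ , ifT b⇓ t , ≈-refl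
  ≈ₚ-sim⁻ (if-false b⇓) t           = _ , ifF b⇓ t , ≈-refl
  ≈ₚ-sim⁻ (unfold {R = R} es⇓ inst) t =
    _ , call-tr es⇓ inst (subst (Δ ⊢_—[ _ ]→ₚ _) (weaken-closed R) t) , ≈-refl

-- Channel occurrences

somewhere-update : ∀ {G Φ p P'} (X : Proc 0 → Set) → p ∈ locs G → (X P' → X (Φ p)) →
                   Σ Loc (λ q → q ∈ locs G × X ((Φ [ p ↦ P' ]) q)) →
                   Σ Loc (λ q → q ∈ locs G × X (Φ q))
somewhere-update {p = p} X p∈G back (q , q∈G , x) with p ≟ q
... | yes refl = p , p∈G , back x
... | no _     = q , q∈G , x

↦-pointwise : (R : Proc 0 → Proc 0 → Set) {Φ Ψ : Loc → Proc 0} {P Q : Proc 0} (p q : Loc) →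
              R P Q → R (Φ q) (Ψ q) → R ((Φ [ p ↦ P ]) q) ((Ψ [ p ↦ Q ]) q)
↦-pointwise R p q PRQ ΦRΨ with p ≟ q
... | yes _ = PRQ
... | no _  = ΦRΨ

module _ {Δ : Env} where

  occP-subP : ∀ {c n m} (σ : Sub n m) (P : Proc n) → OccP Δ c (subP σ P) → OccP Δ c P
  occP-subP σ (inp x P)    inp-here      = inp-here
  occP-subP σ (inp x P)    (inp-there o) = inp-there (occP-subP (liftS σ) P o)
  occP-subP σ (out x e P)  out-here      = out-here
  occP-subP σ (out x e P)  (out-there o) = out-there (occP-subP σ P o)
  occP-subP σ (P ⊞ Q)      (sumL o)      = sumL (occP-subP σ P o)
  occP-subP σ (P ⊞ Q)      (sumR o)      = sumR (occP-subP σ Q o)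
  occP-subP σ (ifte b P Q) (ifL o)       = ifL (occP-subP σ P o)
  occP-subP σ (ifte b P Q) (ifR o)       = ifR (occP-subP σ Q o)
  occP-subP σ (call A es)  (call-body o) = call-body o

  occP-inp⁻ : ∀ {c n x} {P : Proc (suc n)} → OccP Δ c (inp x P) → x ≡ c ⊎ OccP Δ c P
  occP-inp⁻ inp-here      = inj₁ refl
  occP-inp⁻ (inp-there o) = inj₂ o

  occP-inp : ∀ {c n x} {P : Proc (suc n)} → x ≡ c ⊎ OccP Δ c P → OccP Δ c (inp x P)
  occP-inp (inj₁ refl) = inp-here
  occP-inp (inj₂ o)    = inp-there o

  occP-out⁻ : ∀ {c n x e} {P : Proc n} → OccP Δ c (out x e P) → x ≡ c ⊎ OccP Δ c P
  occP-out⁻ out-here      = inj₁ refl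
  occP-out⁻ (out-there o) = inj₂ o

  occP-out : ∀ {c n x e} {P : Proc n} → x ≡ c ⊎ OccP Δ c P → OccP Δ c (out x e P)
  occP-out (inj₁ refl) = out-here
  occP-out (inj₂ o)    = out-there o

  occP-instantiate : ∀ {c} (def : Σ ℕ Proc) vs {R} → instantiate def vs ≡ just R →
                     OccP Δ c R → OccP Δ c (proj₂ def)
  occP-instantiate (n , P) vs inst o with toArgs n vs
  occP-instantiate (n , P) vs refl o | just σ = occP-subP σ P o

  occP-step-chan : ∀ {P α P'} → Δ ⊢ P —[ α ]→ₚ P' → OccP Δ (chanOf α) P
  occP-step-chan (out-tr _) = out-here
  occP-step-chan inp-tr     = inp-here
  occP-step-chan (sumL t)   = sumL (occP-step-chan t)
  occP-step-chan (sumR t)   = sumR (occP-step-chan t)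
  occP-step-chan (ifT _ t)  = ifL (occP-step-chan t)
  occP-step-chan (ifF _ t)  = ifR (occP-step-chan t)
  occP-step-chan (call-tr {A = A} {vs = vs} _ inst t) =
    call-body (occP-instantiate (Δ A) vs inst (occP-step-chan t))

  occP-step : ∀ {c P α P'} → Δ ⊢ P —[ α ]→ₚ P' → OccP Δ c P' → OccP Δ c P
  occP-step (out-tr _)          o = out-there o
  occP-step (inp-tr {P = P})    o = inp-there (occP-subP _ P o)
  occP-step (sumL t)            o = sumL (occP-step t o)
  occP-step (sumR t)            o = sumR (occP-step t o)
  occP-step (ifT _ t)           o = ifL (occP-step t o)
  occP-step (ifF _ t)           o = ifR (occP-step t o)
  occP-step (call-tr {A = A} {vs = vs} _ inst t) o =
    call-body (occP-instantiate (Δ A) vs inst (occP-step t o))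

  occFree-step-chan : ∀ {M M' p α} → Δ ⊢ M —[ p ∶ α ]→ M' → OccFree Δ (chanOf α) M
  occFree-step-chan (loc-tr {p = p} p∈G t) = p , p∈G , occP-step-chan t
  occFree-step-chan (syncL t _ _) = inj₁ (occFree-step-chan t)
  occFree-step-chan (syncR _ t _) = inj₁ (occFree-step-chan t)
  occFree-step-chan (pass c∉δ t)  = c∉δ , occFree-step-chan t
  occFree-step-chan (parL t)      = inj₁ (occFree-step-chan t)
  occFree-step-chan (parR t)      = inj₂ (occFree-step-chan t)

  occFree-step : ∀ {c M M' δ} → Δ ⊢ M —[ δ ]→ M' → OccFree Δ c M' → OccFree Δ c M
  occFree-step {c} (loc-tr {G} {Φ} p∈G t) o =
    somewhere-update {G} {Φ} (OccP Δ c) p∈G (occP-step t) o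
  occFree-step (syncL t _ _)   (inj₁ o) = inj₁ (occFree-step t o)
  occFree-step (syncL _ t _)   (inj₂ o) = inj₂ (occFree-step t o)
  occFree-step (syncR _ t _)   (inj₁ o) = inj₁ (occFree-step t o)
  occFree-step (syncR t _ _)   (inj₂ o) = inj₂ (occFree-step t o)
  occFree-step (hide t)        (c≢ , o) = c≢ , occFree-step t o
  occFree-step (pass _ t)      (c≢ , o) = c≢ , occFree-step t o
  occFree-step (parL t)        (inj₁ o) = inj₁ (occFree-step t o)
  occFree-step (parL _)        (inj₂ o) = inj₂ o
  occFree-step (parR _)        (inj₁ o) = inj₁ o
  occFree-step (parR t)        (inj₂ o) = inj₂ (occFree-step t o)

  occAll-step : ∀ {c M M' δ} → Δ ⊢ M —[ δ ]→ M' → OccAll Δ c M' → OccAll Δ c M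
  occAll-step {c} (loc-tr {G} {Φ} p∈G t) o =
    somewhere-update {G} {Φ} (OccP Δ c) p∈G (occP-step t) o
  occAll-step (syncL t _ _)   (inj₁ o) = inj₁ (occAll-step t o)
  occAll-step (syncL _ t _)   (inj₂ o) = inj₂ (occAll-step t o)
  occAll-step (syncR _ t _)   (inj₁ o) = inj₁ (occAll-step t o)
  occAll-step (syncR t _ _)   (inj₂ o) = inj₂ (occAll-step t o)
  occAll-step (hide t)        o        = ⊎-map₂ (occAll-step t) o
  occAll-step (pass _ t)      o        = ⊎-map₂ (occAll-step t) o
  occAll-step (parL t)        (inj₁ o) = inj₁ (occAll-step t o)
  occAll-step (parL _)        (inj₂ o) = inj₂ o
  occAll-step (parR _)        (inj₁ o) = inj₁ o
  occAll-step (parR t)        (inj₂ o) = inj₂ (occAll-step t o)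

  occFree⇒occAll : ∀ {c} M → OccFree Δ c M → OccAll Δ c M
  occFree⇒occAll (G ⟨ Φ ⟩)    o        = o
  occFree⇒occAll (M ∖ d)      (_ , o)  = inj₂ (occFree⇒occAll M o)
  occFree⇒occAll (M ⊕[ D ] N) (inj₁ o) = inj₁ (occFree⇒occAll M o)
  occFree⇒occAll (M ⊕[ D ] N) (inj₂ o) = inj₂ (occFree⇒occAll N o)

  notOn-step : ∀ {c M M' δ} → ¬ OccFree Δ c M → Δ ⊢ M —[ δ ]→ M' → NotOn c δ
  notOn-step {δ = p ∶ α} c∉M t refl = c∉M (occFree-step-chan t)
  notOn-step {δ = τ}     c∉M t      = tt

  res-swap-sim : ∀ {M c d} → NetSim Δ (M ∖ c ∖ d) (M ∖ d ∖ c)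
  res-swap-sim {c = c} {d} t with c ≟ d
  res-swap-sim t                       | yes refl = _ , t , ≅-refl
  res-swap-sim (hide (pass _ t))       | no _     = _ , pass tt (hide t) , res-swap
  res-swap-sim (pass _ (hide t))       | no c≢d   = _ , hide (pass c≢d t) , res-swap
  res-swap-sim (pass d∉δ (pass c∉δ t)) | no _     = _ , pass c∉δ (pass d∉δ t) , res-swap

  par-comm-sim : ∀ {M N D} → NetSim Δ (M ⊕[ D ] N) (N ⊕[ D ] M)
  par-comm-sim (syncL t u pq) = _ , syncR t u pq , par-comm
  par-comm-sim (syncR t u pq) = _ , syncL t u pq , par-comm
  par-comm-sim (parL t)       = _ , parR t , par-comm
  par-comm-sim (parR t)       = _ , parL t , par-comm

  scope-sim : ∀ {M N D c} → ¬ OccFree Δ c M → NetSim Δ ((M ⊕[ D ] N) ∖ c) (M ⊕[ D ] (N ∖ c))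
  scope-sim c∉M (hide (syncL t _ _))  = ⊥-elim (c∉M (occFree-step-chan t))
  scope-sim c∉M (hide (syncR _ u _))  = ⊥-elim (c∉M (occFree-step-chan u))
  scope-sim c∉M (hide (parL t))       = ⊥-elim (c∉M (occFree-step-chan t))
  scope-sim c∉M (hide (parR t))       = _ , parR (hide t) , scope c∉M
  scope-sim c∉M (pass c∉δ (syncL t u pq)) =
    _ , syncL t (pass c∉δ u) pq , scope (c∉M ∘ occFree-step t)
  scope-sim c∉M (pass c∉δ (syncR t u pq)) =
    _ , syncR (pass c∉δ t) u pq , scope (c∉M ∘ occFree-step u)
  scope-sim c∉M (pass c∉δ (parL t)) = _ , parL t , scope (c∉M ∘ occFree-step t)
  scope-sim c∉M (pass c∉δ (parR t)) = _ , parR (pass c∉δ t) , scope c∉M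

  scope-sim⁻ : ∀ {M N D c} → ¬ OccFree Δ c M → NetSim Δ (M ⊕[ D ] (N ∖ c)) ((M ⊕[ D ] N) ∖ c)
  scope-sim⁻ c∉M (syncL t (pass c∉δ u) pq) =
    _ , pass c∉δ (syncL t u pq) , ≅-sym (scope (c∉M ∘ occFree-step t))
  scope-sim⁻ c∉M (syncR (pass c∉δ t) u pq) =
    _ , pass c∉δ (syncR t u pq) , ≅-sym (scope (c∉M ∘ occFree-step u))
  scope-sim⁻ c∉M (parL t) =
    _ , pass (notOn-step c∉M t) (parL t) , ≅-sym (scope (c∉M ∘ occFree-step t))
  scope-sim⁻ c∉M (parR (hide t))      = _ , hide (parR t) , ≅-sym (scope c∉M)
  scope-sim⁻ c∉M (parR (pass c∉δ t))  = _ , pass c∉δ (parR t) , ≅-sym (scope c∉M)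

-- Channel renaming

renA : Chan → Chan → Act → Act
renA c d (recv x v) = recv (renCh c d x) v
renA c d (send x v) = send (renCh c d x) v

renL : Chan → Chan → Label → Label
renL c d (p ∶ α) = p ∶ renA c d α
renL c d τ       = τ

module _ {c d : Chan} where

  renCh-≢ : ∀ {x} → x ≢ c → renCh c d x ≡ x
  renCh-≢ {x} x≢c with x ≟ c
  ... | yes x≡c = ⊥-elim (x≢c x≡c)
  ... | no _    = refl

  renCh-self : renCh c d c ≡ d
  renCh-self with c ≟ c
  ... | yes _  = refl
  ... | no c≢c = ⊥-elim (c≢c refl)

  renCh-cases : ∀ {x y} → renCh c d x ≡ y → (x ≡ c × d ≡ y) ⊎ (x ≢ c × x ≡ y)
  renCh-cases {x} ren≡ with x ≟ c
  ... | yes x≡c = inj₁ (x≡c , ren≡)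
  ... | no x≢c  = inj₂ (x≢c , ren≡)

  renCh-injective : ∀ {x y} → x ≢ d → y ≢ d → renCh c d x ≡ renCh c d y → x ≡ y
  renCh-injective {x} {y} x≢d y≢d ren≡ with x ≟ c | y ≟ c
  ... | yes x≡c | yes y≡c = trans x≡c (sym y≡c)
  ... | yes _   | no _    = ⊥-elim (y≢d (sym ren≡))
  ... | no _    | yes _   = ⊥-elim (x≢d ren≡)
  ... | no _    | no _    = ren≡

  renCh-≡c : ∀ {x} → renCh c d x ≡ c → x ≡ c
  renCh-≡c {x} ren≡ with renCh-cases {x} ren≡
  ... | inj₁ (x≡c , _) = x≡c
  ... | inj₂ (_ , x≡c) = x≡c

  renCh-≡d : ∀ {x} → x ≢ d → renCh c d x ≡ d → x ≡ c
  renCh-≡d {x} x≢d ren≡ with renCh-cases {x} ren≡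
  ... | inj₁ (x≡c , _) = x≡c
  ... | inj₂ (_ , x≡d) = ⊥-elim (x≢d x≡d)

  renCh-≢d : ∀ {x y} → y ≢ d → renCh c d x ≡ y → x ≡ y
  renCh-≢d {x} y≢d ren≡ with renCh-cases {x} ren≡
  ... | inj₁ (_ , d≡y) = ⊥-elim (y≢d (sym d≡y))
  ... | inj₂ (_ , x≡y) = x≡y

  chanOf-renA : ∀ α → chanOf (renA c d α) ≡ renCh c d (chanOf α)
  chanOf-renA (recv x v) = refl
  chanOf-renA (send x v) = refl

  renA-≢ : ∀ α → chanOf α ≢ c → renA c d α ≡ α
  renA-≢ (recv x v) x≢c = cong (λ y → recv y v) (renCh-≢ x≢c)
  renA-≢ (send x v) x≢c = cong (λ y → send y v) (renCh-≢ x≢c)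

  renL-notOn : ∀ δ → NotOn c δ → renL c d δ ≡ δ
  renL-notOn (p ∶ α) c∉α = cong (p ∶_) (renA-≢ α c∉α)
  renL-notOn τ       _   = refl

  notOn-renL : ∀ {e} δ → NotOn e δ → d ≢ e → NotOn e (renL c d δ)
  notOn-renL (p ∶ α) e∉α d≢e ren≡ with renCh-cases (trans (sym (chanOf-renA α)) ren≡)
  ... | inj₁ (_ , d≡e) = d≢e d≡e
  ... | inj₂ (_ , α≡e) = e∉α α≡e
  notOn-renL τ _ _ = tt

  notOn-renL⁻ : ∀ {e} δ {δ'} → renL c d δ ≡ δ' → NotOn e δ' → e ≢ c → NotOn e δ
  notOn-renL⁻ (p ∶ α) refl e∉ e≢c α≡e =
    e∉ (trans (chanOf-renA α) (trans (cong (renCh c d) α≡e) (renCh-≢ e≢c)))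
  notOn-renL⁻ τ _ _ _ = tt

  notOn-renL⁻-target : ∀ δ {δ'} → renL c d δ ≡ δ' → NotOn d δ' → NotOn c δ
  notOn-renL⁻-target (p ∶ α) refl d∉ α≡c =
    d∉ (trans (chanOf-renA α) (trans (cong (renCh c d) α≡c) renCh-self))
  notOn-renL⁻-target τ _ _ = tt

  module _ {Δ : Env} where

    renP-subP : ∀ {n m} (σ : Sub n m) (P : Proc n) → renP c d (subP σ P) ≡ subP σ (renP c d P)
    renP-subP σ 𝟎            = refl
    renP-subP σ (inp x P)    = cong (inp _) (renP-subP (liftS σ) P)
    renP-subP σ (out x e P)  = cong (out _ _) (renP-subP σ P)
    renP-subP σ (P ⊞ Q)      = cong₂ _⊞_ (renP-subP σ P) (renP-subP σ Q)
    renP-subP σ (ifte b P Q) = cong₂ (ifte _) (renP-subP σ P) (renP-subP σ Q)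
    renP-subP σ (call A es)  = refl

    occP-renP : ∀ {n} (P : Proc n) → OccP Δ c (renP c d P) → OccP Δ c P
    occP-renP (inp x P)   o = occP-inp (⊎-map renCh-≡c (occP-renP P) (occP-inp⁻ o))
    occP-renP (out x e P) o = occP-out (⊎-map renCh-≡c (occP-renP P) (occP-out⁻ o))
    occP-renP (P ⊞ Q)      (sumL o) = sumL (occP-renP P o)
    occP-renP (P ⊞ Q)      (sumR o) = sumR (occP-renP Q o)
    occP-renP (ifte b P Q) (ifL o)  = ifL (occP-renP P o)
    occP-renP (ifte b P Q) (ifR o)  = ifR (occP-renP Q o)
    occP-renP (call A es)  o        = o

    renP-fresh : ∀ {n} (P : Proc n) → ¬ OccP Δ c P → renP c d P ≡ P
    renP-fresh 𝟎 _ = refl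
    renP-fresh (inp x P) c∉ =
      cong₂ inp (renCh-≢ (c∉ ∘ occP-inp ∘ inj₁)) (renP-fresh P (c∉ ∘ occP-inp ∘ inj₂))
    renP-fresh (out x e P) c∉ =
      cong₂ (λ y → out y e) (renCh-≢ (c∉ ∘ occP-out ∘ inj₁))
                            (renP-fresh P (c∉ ∘ occP-out ∘ inj₂))
    renP-fresh (P ⊞ Q) c∉ = cong₂ _⊞_ (renP-fresh P (c∉ ∘ sumL)) (renP-fresh Q (c∉ ∘ sumR))
    renP-fresh (ifte b P Q) c∉ =
      cong₂ (ifte b) (renP-fresh P (c∉ ∘ ifL)) (renP-fresh Q (c∉ ∘ ifR))
    renP-fresh (call A es) _ = refl

    -- renP does not enter constant bodies, so a call must be free of c to be unaffected.
    call-step-fresh : ∀ {A es α R'} → ¬ OccP Δ c (call {0} A es) → Δ ⊢ call A es —[ α ]→ₚ R' →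
                      renA c d α ≡ α × renP c d R' ≡ R'
    call-step-fresh c∉ t =
      renA-≢ _ (λ α≡c → c∉ (subst (λ x → OccP Δ x _) α≡c (occP-step-chan t))) ,
      renP-fresh _ (c∉ ∘ occP-step t)

    renP-step : ∀ {P α P'} → Δ ⊢ P —[ α ]→ₚ P' → ¬ OccP Δ c (renP c d P) →
                Δ ⊢ renP c d P —[ renA c d α ]→ₚ renP c d P'
    renP-step (out-tr e⇓)      _  = out-tr e⇓
    renP-step (inp-tr {P = P}) _  = subst (Δ ⊢ _ —[ _ ]→ₚ_) (sym (renP-subP _ P)) inp-tr
    renP-step (sumL t)         c∉ = sumL (renP-step t (c∉ ∘ sumL))
    renP-step (sumR t)         c∉ = sumR (renP-step t (c∉ ∘ sumR))
    renP-step (ifT b⇓ t)       c∉ = ifT b⇓ (renP-step t (c∉ ∘ ifL))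
    renP-step (ifF b⇓ t)       c∉ = ifF b⇓ (renP-step t (c∉ ∘ ifR))
    renP-step t@(call-tr _ _ _) c∉ with α≡ , R'≡ ← call-step-fresh c∉ t =
      subst₂ (Δ ⊢ _ —[_]→ₚ_) (sym α≡) (sym R'≡) t

    renP-step⁻ : ∀ (P : Proc 0) {β Q} → Δ ⊢ renP c d P —[ β ]→ₚ Q → ¬ OccP Δ c (renP c d P) →
                 Σ Act λ α → Σ (Proc 0) λ P' →
                   (Δ ⊢ P —[ α ]→ₚ P') × renA c d α ≡ β × Q ≡ renP c d P'
    renP-step⁻ (inp x P)   (inp-tr {v = v})    _ =
      recv x v , _ , inp-tr , refl , sym (renP-subP _ P)
    renP-step⁻ (out x e P) (out-tr {v = v} e⇓) _ =
      send x v , P , out-tr e⇓ , refl , refl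
    renP-step⁻ (P ⊞ Q) (sumL t) c∉ = map₂ (map₂ (map₁ sumL)) (renP-step⁻ P t (c∉ ∘ sumL))
    renP-step⁻ (P ⊞ Q) (sumR t) c∉ = map₂ (map₂ (map₁ sumR)) (renP-step⁻ Q t (c∉ ∘ sumR))
    renP-step⁻ (ifte b P Q) (ifT b⇓ t) c∉ =
      map₂ (map₂ (map₁ (ifT b⇓))) (renP-step⁻ P t (c∉ ∘ ifL))
    renP-step⁻ (ifte b P Q) (ifF b⇓ t) c∉ =
      map₂ (map₂ (map₁ (ifF b⇓))) (renP-step⁻ Q t (c∉ ∘ ifR))
    renP-step⁻ (call A es) t c∉ with α≡ , R'≡ ← call-step-fresh c∉ t = _ , _ , t , α≡ , sym R'≡

    occP-renP-step : ∀ {P α P'} → Δ ⊢ P —[ α ]→ₚ P' →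
                     OccP Δ c (renP c d P') → OccP Δ c (renP c d P)
    occP-renP-step (out-tr _) o = out-there o
    occP-renP-step (inp-tr {P = P}) o =
      inp-there (occP-subP _ (renP c d P) (subst (OccP Δ c) (renP-subP _ P) o))
    occP-renP-step (sumL t)  o = sumL (occP-renP-step t o)
    occP-renP-step (sumR t)  o = sumR (occP-renP-step t o)
    occP-renP-step (ifT _ t) o = ifL (occP-renP-step t o)
    occP-renP-step (ifF _ t) o = ifR (occP-renP-step t o)
    occP-renP-step t@(call-tr _ _ _) o = occP-step t (occP-renP _ o)

    record Renamable (M : Net) : Set where
      constructor _,_
      field
        target-fresh  : ¬ OccAll Δ d M
        source-absent : ¬ OccFree Δ c (renN c d M)

    occFree-renN-∖⁻ : ∀ {M e} → OccFree Δ c (renN c d (M ∖ e)) → e ≢ c × OccFree Δ c (renN c d M)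
    occFree-renN-∖⁻ {e = e} o with e ≟ c
    ... | yes e≡c = ⊥-elim (proj₁ o (sym e≡c))
    ... | no e≢c  = e≢c , proj₂ o

    occFree-renN-∖ : ∀ {M e} → e ≢ c → OccFree Δ c (renN c d M) → OccFree Δ c (renN c d (M ∖ e))
    occFree-renN-∖ {e = e} e≢c o with e ≟ c
    ... | yes e≡c = ⊥-elim (e≢c e≡c)
    ... | no _    = ≢-sym e≢c , o

    renN-∖-bound : ∀ {M} → renN c d (M ∖ c) ≡ M ∖ c
    renN-∖-bound with c ≟ c
    ... | yes _  = refl
    ... | no c≢c = ⊥-elim (c≢c refl)

    renN-∖-free : ∀ {M e} → e ≢ c → renN c d (M ∖ e) ≡ renN c d M ∖ e
    renN-∖-free {e = e} e≢c with e ≟ c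
    ... | yes e≡c = ⊥-elim (e≢c e≡c)
    ... | no _    = refl

    renamable-∖ : ∀ {M e} → e ≢ c → Renamable (M ∖ e) → Renamable M
    renamable-∖ e≢c (d∉ , c∉) = d∉ ∘ inj₂ , c∉ ∘ occFree-renN-∖ e≢c

    renamable-⊕ˡ : ∀ {M N D} → Renamable (M ⊕[ D ] N) → Renamable M
    renamable-⊕ˡ (d∉ , c∉) = d∉ ∘ inj₁ , c∉ ∘ inj₁

    renamable-⊕ʳ : ∀ {M N D} → Renamable (M ⊕[ D ] N) → Renamable N
    renamable-⊕ʳ (d∉ , c∉) = d∉ ∘ inj₂ , c∉ ∘ inj₂

    occFree-renN-step : ∀ {M M' δ} → Δ ⊢ M —[ δ ]→ M' →
                        OccFree Δ c (renN c d M') → OccFree Δ c (renN c d M)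
    occFree-renN-step (loc-tr {G} {Φ} p∈G t) o =
      somewhere-update {G} {Φ} (λ P → OccP Δ c (renP c d P)) p∈G (occP-renP-step t) o
    occFree-renN-step (syncL t _ _) (inj₁ o) = inj₁ (occFree-renN-step t o)
    occFree-renN-step (syncL _ u _) (inj₂ o) = inj₂ (occFree-renN-step u o)
    occFree-renN-step (syncR _ u _) (inj₁ o) = inj₁ (occFree-renN-step u o)
    occFree-renN-step (syncR t _ _) (inj₂ o) = inj₂ (occFree-renN-step t o)
    occFree-renN-step (hide t) o with e≢c , o′ ← occFree-renN-∖⁻ o =
      occFree-renN-∖ e≢c (occFree-renN-step t o′)
    occFree-renN-step (pass _ t) o with e≢c , o′ ← occFree-renN-∖⁻ o =
      occFree-renN-∖ e≢c (occFree-renN-step t o′)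
    occFree-renN-step (parL t) (inj₁ o) = inj₁ (occFree-renN-step t o)
    occFree-renN-step (parL _) (inj₂ o) = inj₂ o
    occFree-renN-step (parR _) (inj₁ o) = inj₁ o
    occFree-renN-step (parR t) (inj₂ o) = inj₂ (occFree-renN-step t o)

    renamable-step : ∀ {M M' δ} → Δ ⊢ M —[ δ ]→ M' → Renamable M → Renamable M'
    renamable-step t (d∉ , c∉) = d∉ ∘ occAll-step t , c∉ ∘ occFree-renN-step t

    renN-step : ∀ {M M' δ} → Δ ⊢ M —[ δ ]→ M' → Renamable M →
                Σ Net λ K → (Δ ⊢ renN c d M —[ renL c d δ ]→ K) × (Δ ⊢ K ≅ renN c d M')
    renN-step (loc-tr {p = p} p∈G t) (_ , c∉) =
      _ , loc-tr p∈G (renP-step t (λ o → c∉ (p , p∈G , o))) ,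
      loc-cong λ q _ → ↦-pointwise (λ P Q → Δ ⊢ P ≈ₚ renP c d Q) p q ≈-refl ≈-refl
    renN-step (syncL t u pq) r with K , t′ , k ← renN-step t (renamable-⊕ˡ r)
                                   | L , u′ , l ← renN-step u (renamable-⊕ʳ r) =
      _ , syncL t′ u′ pq , par-cong k l
    renN-step (syncR t u pq) r with K , t′ , k ← renN-step t (renamable-⊕ʳ r)
                                   | L , u′ , l ← renN-step u (renamable-⊕ˡ r) =
      _ , syncR t′ u′ pq , par-cong l k
    renN-step (hide {c = e} t) r with e ≟ c
    ... | yes refl = _ , hide t , ≅-refl
    ... | no e≢c with K , t′ , k ← renN-step t (renamable-∖ e≢c r) =
      _ , hide (subst (λ x → Δ ⊢ _ —[ _ ∶ send x _ ]→ K) (renCh-≢ e≢c) t′) , res-cong k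
    renN-step (pass {δ = δ} {c = e} e∉δ t) r with e ≟ c
    ... | yes refl = _ , subst (Δ ⊢ _ —[_]→ _) (sym (renL-notOn δ e∉δ)) (pass e∉δ t) , ≅-refl
    ... | no e≢c with K , t′ , k ← renN-step t (renamable-∖ e≢c r) =
      _ , pass (notOn-renL δ e∉δ (Renamable.target-fresh r ∘ inj₁)) t′ , res-cong k
    renN-step (parL t) r with K , t′ , k ← renN-step t (renamable-⊕ˡ r) =
      _ , parL t′ , par-cong k ≅-refl
    renN-step (parR t) r with K , t′ , k ← renN-step t (renamable-⊕ʳ r) =
      _ , parR t′ , par-cong ≅-refl k

    step-chan-≢-target : ∀ {M M' p α} → Renamable M → Δ ⊢ M —[ p ∶ α ]→ M' → chanOf α ≢ d
    step-chan-≢-target (d∉ , _) t α≡d =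
      d∉ (occFree⇒occAll _ (subst (λ x → OccFree Δ x _) α≡d (occFree-step-chan t)))

    send-unrenamed : ∀ {M M' δ p y v} → Renamable M → Δ ⊢ M —[ δ ]→ M' →
                     renL c d δ ≡ p ∶ send y v →
                     Σ Chan λ x → (Δ ⊢ M —[ p ∶ send x v ]→ M') × renCh c d x ≡ y × x ≢ d
    send-unrenamed {δ = _ ∶ send x _} r t refl = x , t , refl , step-chan-≢-target r t

    recv-unrenamed : ∀ {M M' δ p y v} → Renamable M → Δ ⊢ M —[ δ ]→ M' →
                     renL c d δ ≡ p ∶ recv y v →
                     Σ Chan λ x → (Δ ⊢ M —[ p ∶ recv x v ]→ M') × renCh c d x ≡ y × x ≢ d
    recv-unrenamed {δ = _ ∶ recv x _} r t refl = x , t , refl , step-chan-≢-target r t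

    sync-unrenamed : ∀ {M M' N N' δ₁ δ₂ p q y v} → Renamable M → Renamable N →
                     Δ ⊢ M —[ δ₁ ]→ M' → renL c d δ₁ ≡ p ∶ send y v →
                     Δ ⊢ N —[ δ₂ ]→ N' → renL c d δ₂ ≡ q ∶ recv y v →
                     Σ Chan λ x → (Δ ⊢ M —[ p ∶ send x v ]→ M') × (Δ ⊢ N —[ q ∶ recv x v ]→ N') ×
                                  renCh c d x ≡ y
    sync-unrenamed rM rN t δ₁↦ u δ₂↦
      with x , t′ , x↦ , x≢d ← send-unrenamed rM t δ₁↦
         | y , u′ , y↦ , y≢d ← recv-unrenamed rN u δ₂↦
      with refl ← renCh-injective x≢d y≢d (trans x↦ (sym y↦))
      = x , t′ , u′ , x↦

    Unrenamed : Net → Label → Net → Set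
    Unrenamed M δ K =
      Σ Label λ δ₀ → Σ Net λ M' → (Δ ⊢ M —[ δ₀ ]→ M') × renL c d δ₀ ≡ δ × (Δ ⊢ K ≅ renN c d M')

    renN-step⁻ : ∀ M {δ K} → Δ ⊢ renN c d M —[ δ ]→ K → Renamable M → Unrenamed M δ K
    renN-step⁻ (G ⟨ Φ ⟩) (loc-tr {p = p} p∈G t) (_ , c∉)
      with α , P' , t₀ , α↦ , Q≡ ← renP-step⁻ (Φ p) t (λ o → c∉ (p , p∈G , o)) =
      p ∶ α , _ , loc-tr p∈G t₀ , cong (p ∶_) α↦ ,
      loc-cong λ q _ →
        ↦-pointwise (λ P Q → Δ ⊢ P ≈ₚ renP c d Q) p q (subst (Δ ⊢ _ ≈ₚ_) Q≡ ≈-refl) ≈-refl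
    renN-step⁻ (M ∖ e) t r with e ≟ c
    renN-step⁻ (M ∖ e) (hide t) r | yes refl =
      τ , _ , hide t , refl , subst (Δ ⊢ _ ≅_) (sym renN-∖-bound) ≅-refl
    renN-step⁻ (M ∖ e) (pass {δ = δ} e∉δ t) r | yes refl =
      δ , _ , pass e∉δ t , renL-notOn δ e∉δ , subst (Δ ⊢ _ ≅_) (sym renN-∖-bound) ≅-refl
    renN-step⁻ (M ∖ e) (hide t) r | no e≢c
      with δ₀ , M' , t₀ , δ₀↦ , k ← renN-step⁻ M t (renamable-∖ e≢c r)
      with x , t₁ , x↦e , _ ← send-unrenamed (renamable-∖ e≢c r) t₀ δ₀↦
      with refl ← renCh-≢d {x} (Renamable.target-fresh r ∘ inj₁ ∘ sym) x↦e
      = τ , _ , hide t₁ , refl , subst (Δ ⊢ _ ≅_) (sym (renN-∖-free e≢c)) (res-cong k)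
    renN-step⁻ (M ∖ e) (pass e∉δ t) r | no e≢c
      with δ₀ , M' , t₀ , δ₀↦ , k ← renN-step⁻ M t (renamable-∖ e≢c r) =
      δ₀ , _ , pass (notOn-renL⁻ δ₀ δ₀↦ e∉δ e≢c) t₀ , δ₀↦ ,
      subst (Δ ⊢ _ ≅_) (sym (renN-∖-free e≢c)) (res-cong k)
    renN-step⁻ (M ⊕[ D ] N) (syncL t u pq) r
      with _ , _ , t₀ , δ₁↦ , k ← renN-step⁻ M t (renamable-⊕ˡ r)
         | _ , _ , u₀ , δ₂↦ , l ← renN-step⁻ N u (renamable-⊕ʳ r)
      with _ , t₁ , u₁ , x↦ ← sync-unrenamed (renamable-⊕ˡ r) (renamable-⊕ʳ r) t₀ δ₁↦ u₀ δ₂↦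
      = _ , _ , syncL t₁ u₁ pq , cong (λ x → _ ∶ send x _) x↦ , par-cong k l
    renN-step⁻ (M ⊕[ D ] N) (syncR t u pq) r
      with _ , _ , t₀ , δ₁↦ , k ← renN-step⁻ N t (renamable-⊕ʳ r)
         | _ , _ , u₀ , δ₂↦ , l ← renN-step⁻ M u (renamable-⊕ˡ r)
      with _ , t₁ , u₁ , x↦ ← sync-unrenamed (renamable-⊕ʳ r) (renamable-⊕ˡ r) t₀ δ₁↦ u₀ δ₂↦
      = _ , _ , syncR t₁ u₁ pq , cong (λ x → _ ∶ send x _) x↦ , par-cong l k
    renN-step⁻ (M ⊕[ D ] N) (parL t) r
      with δ₀ , _ , t₀ , δ₀↦ , k ← renN-step⁻ M t (renamable-⊕ˡ r) =
      δ₀ , _ , parL t₀ , δ₀↦ , par-cong k ≅-refl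
    renN-step⁻ (M ⊕[ D ] N) (parR t) r
      with δ₀ , _ , t₀ , δ₀↦ , k ← renN-step⁻ N t (renamable-⊕ʳ r) =
      δ₀ , _ , parR t₀ , δ₀↦ , par-cong ≅-refl k

    ≅-alpha : ∀ {M} → Renamable M → Δ ⊢ M ∖ c ≅ renN c d M ∖ d
    ≅-alpha (d∉ , c∉) = alpha d∉ c∉

    alpha-sim : ∀ {M} → Renamable M → NetSim Δ (M ∖ c) (renN c d M ∖ d)
    alpha-sim {M} r (hide {p = p} {v = v} t) with K , t′ , k ← renN-step t r =
      _ , hide (subst (λ x → Δ ⊢ renN c d M —[ p ∶ send x v ]→ K) renCh-self t′) ,
      ≅-trans (≅-alpha (renamable-step t r)) (res-cong (≅-sym k))
    alpha-sim r (pass {δ = δ} c∉δ t) with K , t′ , k ← renN-step t r =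
      _ , pass (notOn-step (Renamable.target-fresh r ∘ occFree⇒occAll _) t)
               (subst (Δ ⊢ _ —[_]→ K) (renL-notOn δ c∉δ) t′) ,
      ≅-trans (≅-alpha (renamable-step t r)) (res-cong (≅-sym k))

    alpha-sim⁻ : ∀ {M} → Renamable M → NetSim Δ (renN c d M ∖ d) (M ∖ c)
    alpha-sim⁻ {M} r (hide t)
      with δ₀ , M' , t₀ , δ₀↦ , k ← renN-step⁻ M t r
      with x , t₁ , x↦d , x≢d ← send-unrenamed r t₀ δ₀↦
      with refl ← renCh-≡d {x} x≢d x↦d
      = _ , hide t₁ , ≅-trans (res-cong k) (≅-sym (≅-alpha (renamable-step t₁ r)))
    alpha-sim⁻ {M} r (pass d∉δ t) with δ₀ , M' , t₀ , δ₀↦ , k ← renN-step⁻ M t r =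
      _ , subst (Δ ⊢ _ —[_]→ _) (trans (sym (renL-notOn δ₀ c∉δ₀)) δ₀↦) (pass c∉δ₀ t₀) ,
      ≅-trans (res-cong k) (≅-sym (≅-alpha (renamable-step t₀ r)))
      where c∉δ₀ = notOn-renL⁻-target δ₀ δ₀↦ d∉δ

-- Structural congruence of networks is a bisimulation

module _ {Δ : Env} where

  open Simulation (Δ ⊢_—[_]→_) (Δ ⊢_≅_) using (sim-refl; sim-trans)

  ∖-sim : ∀ {M N c} → NetSim Δ M N → NetSim Δ (M ∖ c) (N ∖ c)
  ∖-sim M≲N (hide t)     with _ , t′ , k ← M≲N t = _ , hide t′ , res-cong k
  ∖-sim M≲N (pass c∉δ t) with _ , t′ , k ← M≲N t = _ , pass c∉δ t′ , res-cong k

  ⊕-sim : ∀ {M M' N N' D} → Δ ⊢ M ≅ M' → Δ ⊢ N ≅ N' → NetSim Δ M M' → NetSim Δ N N' →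
          NetSim Δ (M ⊕[ D ] N) (M' ⊕[ D ] N')
  ⊕-sim M≅M' N≅N' M≲M' N≲N' (syncL t u pq)
    with _ , t′ , k ← M≲M' t | _ , u′ , l ← N≲N' u = _ , syncL t′ u′ pq , par-cong k l
  ⊕-sim M≅M' N≅N' M≲M' N≲N' (syncR t u pq)
    with _ , t′ , k ← N≲N' t | _ , u′ , l ← M≲M' u = _ , syncR t′ u′ pq , par-cong l k
  ⊕-sim M≅M' N≅N' M≲M' N≲N' (parL t) with _ , t′ , k ← M≲M' t = _ , parL t′ , par-cong k N≅N'
  ⊕-sim M≅M' N≅N' M≲M' N≲N' (parR t) with _ , t′ , l ← N≲N' t = _ , parR t′ , par-cong M≅M' l

  loc-sim : ∀ {G Φ Ψ} → (∀ p → p ∈ locs G → Δ ⊢ Φ p ≈ₚ Ψ p) → NetSim Δ (G ⟨ Φ ⟩) (G ⟨ Ψ ⟩)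
  loc-sim Φ≈Ψ (loc-tr {p = p} p∈G t) with Q' , t′ , P'≈Q' ← ≈ₚ-sim (Φ≈Ψ p p∈G) t =
    _ , loc-tr p∈G t′ , loc-cong λ q q∈G → ↦-pointwise (Δ ⊢_≈ₚ_) p q P'≈Q' (Φ≈Ψ q q∈G)

  ≅-sim  : ∀ {M N} → Δ ⊢ M ≅ N → NetSim Δ M N
  ≅-sim⁻ : ∀ {M N} → Δ ⊢ M ≅ N → NetSim Δ N M

  ≅-sim ≅-refl            = sim-refl ≅-refl
  ≅-sim (≅-sym N≅M)       = ≅-sim⁻ N≅M
  ≅-sim (≅-trans M≅N N≅K) = sim-trans ≅-trans (≅-sim M≅N) (≅-sim N≅K)
  ≅-sim (res-cong M≅N)    = ∖-sim (≅-sim M≅N)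
  ≅-sim (par-cong M≅M' N≅N') = ⊕-sim M≅M' N≅N' (≅-sim M≅M') (≅-sim N≅N')
  ≅-sim (loc-cong Φ≈Ψ)    = loc-sim Φ≈Ψ
  ≅-sim res-swap          = res-swap-sim
  ≅-sim par-comm          = par-comm-sim
  ≅-sim (scope c∉M)       = scope-sim c∉M
  ≅-sim (alpha d∉M c∉M′)  = alpha-sim (d∉M , c∉M′)

  ≅-sim⁻ ≅-refl            = sim-refl ≅-refl
  ≅-sim⁻ (≅-sym N≅M)       = ≅-sim N≅M
  ≅-sim⁻ (≅-trans M≅N N≅K) = sim-trans ≅-trans (≅-sim⁻ N≅K) (≅-sim⁻ M≅N)
  ≅-sim⁻ (res-cong M≅N)    = ∖-sim (≅-sim⁻ M≅N)
  ≅-sim⁻ (par-cong M≅M' N≅N') =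
    ⊕-sim (≅-sym M≅M') (≅-sym N≅N') (≅-sim⁻ M≅M') (≅-sim⁻ N≅N')
  ≅-sim⁻ (loc-cong Φ≈Ψ)    = loc-sim λ p p∈G → ≈-sym (Φ≈Ψ p p∈G)
  ≅-sim⁻ res-swap          = res-swap-sim
  ≅-sim⁻ par-comm          = par-comm-sim
  ≅-sim⁻ (scope c∉M)       = scope-sim⁻ c∉M
  ≅-sim⁻ (alpha d∉M c∉M′)  = alpha-sim⁻ (d∉M , c∉M′)

lemma3 : (Δ : Env) {M M' N : Net} {δ : Label} →
         Δ ⊢ M —[ δ ]→ M' → Δ ⊢ M ≅ N →
         Σ Net (λ N' → (Δ ⊢ N —[ δ ]→ N') × (Δ ⊢ M' ≅ N'))
lemma3 Δ M⟶M' M≅N = ≅-sim M≅N M⟶M'
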